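{- Let $n\in\mathbb{N}$. In the quasi-crystal graph $\Gamma_n$, the Schützenberger involution $\sharp$ maps connected components onto connected components; more precisely, if there is an edge from $u$ to $v$ labelled $i$, then there is an edge from $v^\sharp$ to $u^\sharp$ labelled $n-i$.
   Context: $\mathcal{A}_n=\{1<\dots<n\}$. The Schützenberger involution $\sharp:\mathcal{A}_n^*\to\mathcal{A}_n^*$ sends a letter $a$ to $n-a+1$ and a word $a_1\cdots a_k$ to $a_k^\sharp\cdots a_1^\sharp$. A word $u$ has an $i$-inversion if it contains a letter $i+1$ left of a letter $i$. Quasi-Kashiwara operators: if $u$ has an $i$-inversion, $e_i(u),f_i(u)$ are undefined; otherwise $e_i(u)$ replaces the leftmost letter $i+1$ by $i$ (undefined if none) and $f_i(u)$ replaces the rightmost letter $i$ by $i+1$ (undefined if none). The quasi-crystal graph $\Gamma_n$ has vertex set $\mathcal{A}_n^*$ and an edge $u\to f_i(u)$ labelled $i$ whenever $f_i(u)$ is defined, $i\in\{1,\dots,n-1\}$. -}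

module Defs where

open import Data.Nat using (ℕ; suc)
open import Data.Fin using (Fin; toℕ; opposite)
open import Data.List using (List; []; _∷_; _++_; reverse; map; [_])
open import Data.List.Relation.Unary.All using (All)
open import Data.Product using (Σ; ∃; _×_; _,_)
open import Relation.Binary.PropositionalEquality using (_≡_; _≢_)
open import Relation.Nullary using (¬_)

-- The alphabet A_n = {1 < ... < n} is modelled by Fin n;
-- the element a : Fin n stands for the letter  val a = toℕ a + 1.
Letter : ℕ → Set
Letter n = Fin n

Word : ℕ → Set
Word n = List (Letter n)

val : ∀ {n} → Letter n → ℕ
val a = suc (toℕ a)

-- Schützenberger involution on letters: a ↦ n - a + 1
-- (Fin.opposite a has toℕ = n - 1 - toℕ a, i.e. value n - val a + 1).
♯L : ∀ {n} → Letter n → Letter n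
♯L = opposite

♯ : ∀ {n} → Word n → Word n
♯ u = reverse (map ♯L u)

HasInversion : ∀ {n} → ℕ → Word n → Set
HasInversion {n} i u =
  Σ (Word n) λ p → Σ (Letter n) λ a → Σ (Word n) λ m → Σ (Letter n) λ b → Σ (Word n) λ s →
    (u ≡ p ++ a ∷ m ++ b ∷ s) × (val a ≡ suc i) × (val b ≡ i)

-- The quasi-Kashiwara operator f_i, as its graph:  F i u v  iff  f_i(u) is
-- defined and equals v.  f_i(u) is defined iff u has no i-inversion and
-- contains a letter i; it replaces the rightmost letter i by i+1.
F : ∀ {n} → ℕ → Word n → Word n → Set
F {n} i u v =
  ¬ HasInversion i u ×
  Σ (Word n) λ p → Σ (Letter n) λ a → Σ (Letter n) λ b → Σ (Word n) λ s →
    (u ≡ p ++ a ∷ s) × (v ≡ p ++ b ∷ s) ×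
    (val a ≡ i) × (val b ≡ suc i) × All (λ c → val c ≢ i) s

Edge : (n : ℕ) → ℕ → Word n → Word n → Set
Edge n i u v = (1 Data.Nat.≤ i) × (i Data.Nat.< n) × F i u v

-- ♯ reverses a word and complements its letters, so an i-edge  p a s → p b s
-- (a = i the rightmost i, b = i + 1) becomes  ♯s ♯b ♯p → ♯s ♯a ♯p  with
-- ♯b = n - i and ♯a = n - i + 1, which is an (n - i)-edge: the letter ♯b is the
-- rightmost n - i because p contains no i + 1 (else u had an i-inversion), and an
-- (n - i)-inversion of ♯v would be an i-inversion of v lying inside p, hence of u.
module Submission where

open import Defs
open import Data.Nat using (ℕ; suc; _∸_; _≤_)
open import Data.Nat.Properties
  using (+-∸-assoc; m∸[m∸n]≡n; m∸n≤m; m<n⇒0<n∸m; ∸-monoʳ-<; <⇒≤; 1+n≢n)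
open import Data.Fin.Properties using (opposite-prop; opposite-involutive; toℕ<n)
open import Data.List using (List; []; _∷_; _++_; reverse; map; [_])
open import Data.List.Properties using (++-assoc; map-++; reverse-++; unfold-reverse; ∷-injective)
open import Data.List.Relation.Unary.All as All using (All)
open import Data.List.Relation.Unary.All.Properties using (++⁻ʳ)
open import Data.List.Relation.Unary.Any.Properties using (reverse⁻)
open import Data.List.Membership.Propositional.Properties using (∈-map⁻; ∈-∃++)
open import Data.List.Membership.Propositional using (_∈_)
open import Data.Product using (∃; _×_; _,_)
open import Data.Empty using (⊥-elim)
open import Function using (_∘_)
open import Relation.Binary.PropositionalEquality
  using (_≡_; _≢_; refl; sym; trans; cong; cong₂; subst; module ≡-Reasoning)
open import Relation.Nullary using (¬_)

val-♯L : ∀ {n} (a : Letter n) → val (♯L a) ≡ suc n ∸ val a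
val-♯L a = trans (cong suc (opposite-prop a)) (sym (+-∸-assoc 1 (toℕ<n a)))

val-♯L-suc : ∀ {n k} {a : Letter n} → val a ≡ suc k → val (♯L a) ≡ n ∸ k
val-♯L-suc {a = a} refl = val-♯L a

val-♯L-≤ : ∀ {n k} {a : Letter n} → k ≤ n → val a ≡ k → val (♯L a) ≡ suc (n ∸ k)
val-♯L-≤ {a = a} k≤n refl = trans (val-♯L a) (+-∸-assoc 1 k≤n)

val-♯L-∸ : ∀ {n i} {c : Letter n} → i ≤ n → val c ≡ n ∸ i → val (♯L c) ≡ suc i
val-♯L-∸ {n} {i} i≤n e = trans (val-♯L-≤ (m∸n≤m n i) e) (cong suc (m∸[m∸n]≡n i≤n))

♯-++-∷ : ∀ {n} (p : Word n) x s → ♯ (p ++ x ∷ s) ≡ ♯ s ++ ♯L x ∷ ♯ p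
♯-++-∷ p x s = begin
  reverse (map ♯L (p ++ x ∷ s))                   ≡⟨ cong reverse (map-++ ♯L p (x ∷ s)) ⟩
  reverse (map ♯L p ++ ♯L x ∷ map ♯L s)           ≡⟨ reverse-++ (map ♯L p) (♯L x ∷ map ♯L s) ⟩
  reverse (♯L x ∷ map ♯L s) ++ ♯ p                ≡⟨ cong (_++ ♯ p) (unfold-reverse (♯L x) (map ♯L s)) ⟩
  (♯ s ++ [ ♯L x ]) ++ ♯ p                        ≡⟨ ++-assoc (♯ s) [ ♯L x ] (♯ p) ⟩
  ♯ s ++ ♯L x ∷ ♯ p                               ∎
  where open ≡-Reasoning

♯-involutive : ∀ {n} (w : Word n) → ♯ (♯ w) ≡ w
♯-involutive [] = refl
♯-involutive (x ∷ w) = begin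
  ♯ (♯ ([] ++ x ∷ w))            ≡⟨ cong ♯ (♯-++-∷ [] x w) ⟩
  ♯ (♯ w ++ ♯L x ∷ [])           ≡⟨ ♯-++-∷ (♯ w) (♯L x) [] ⟩
  ♯L (♯L x) ∷ ♯ (♯ w)            ≡⟨ cong₂ _∷_ (opposite-involutive x) (♯-involutive w) ⟩
  x ∷ w                          ∎
  where open ≡-Reasoning

All-♯⁺ : ∀ {n} {P : Letter n → Set} {w : Word n} → All (P ∘ ♯L) w → All P (♯ w)
All-♯⁺ {P = P} h = All.tabulate λ x∈♯w → from-preimage (∈-map⁻ ♯L (reverse⁻ x∈♯w))
  where
  from-preimage : ∀ {x} → ∃ (λ y → y ∈ _ × x ≡ ♯L y) → P x
  from-preimage (y , y∈w , refl) = All.lookup h y∈w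

∷-in-++-prefix : ∀ {A : Set} {P : A → Set} (p : List A) {s q r x} →
  P x → All (¬_ ∘ P) s → p ++ s ≡ q ++ x ∷ r → ∃ λ r′ → p ≡ q ++ x ∷ r′
∷-in-++-prefix [] {q = q} px ¬Ps refl = ⊥-elim (All.head (++⁻ʳ q ¬Ps) px)
∷-in-++-prefix (y ∷ p) {q = []} px ¬Ps eq with refl , _ ← ∷-injective eq = p , refl
∷-in-++-prefix (y ∷ p) {q = z ∷ q} px ¬Ps eq
  with refl , eq′ ← ∷-injective eq
  with r′ , refl ← ∷-in-++-prefix p px ¬Ps eq′ = r′ , refl

HasInversion-++ʳ : ∀ {n i} {w : Word n} q → HasInversion i w → HasInversion i (w ++ q)
HasInversion-++ʳ q (P , B , M , A , S , refl , vB , vA) =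
  P , B , M , A , S ++ q , trans (++-assoc P _ q) (cong (λ t → P ++ B ∷ t) (++-assoc M (A ∷ S) q)) , vB , vA

HasInversion-++-∷⁻ : ∀ {n i} (p : Word n) {b s} → val b ≢ i → All (λ c → val c ≢ i) s →
  HasInversion i (p ++ b ∷ s) → HasInversion i p
HasInversion-++-∷⁻ {i = i} p vb≢i s≢i (P , B , M , A , S , e , vB , vA)
  with r′ , refl ← ∷-in-++-prefix {P = λ c → val c ≡ i} p vA (vb≢i All.∷ s≢i)
                     (trans e (sym (++-assoc P (B ∷ M) (A ∷ S))))
  = P , B , M , A , r′ , ++-assoc P (B ∷ M) (A ∷ r′) , vB , vA

HasInversion-♯⁻ : ∀ {n i} {w : Word n} → i ≤ n → HasInversion (n ∸ i) (♯ w) → HasInversion i w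
HasInversion-♯⁻ {w = w} i≤n (P , A , M , B , S , e , vA , vB) =
  ♯ S , ♯L B , ♯ M , ♯L A , ♯ P , w≡ , val-♯L-∸ i≤n vB , trans (val-♯L-suc vA) (m∸[m∸n]≡n i≤n)
  where
  open ≡-Reasoning
  w≡ : w ≡ ♯ S ++ ♯L B ∷ ♯ M ++ ♯L A ∷ ♯ P
  w≡ = begin
    w                                     ≡⟨ sym (♯-involutive w) ⟩
    ♯ (♯ w)                               ≡⟨ cong ♯ e ⟩
    ♯ (P ++ A ∷ M ++ B ∷ S)               ≡⟨ ♯-++-∷ P A (M ++ B ∷ S) ⟩
    ♯ (M ++ B ∷ S) ++ ♯L A ∷ ♯ P          ≡⟨ cong (_++ ♯L A ∷ ♯ P) (♯-++-∷ M B S) ⟩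
    (♯ S ++ ♯L B ∷ ♯ M) ++ ♯L A ∷ ♯ P     ≡⟨ ++-assoc (♯ S) (♯L B ∷ ♯ M) (♯L A ∷ ♯ P) ⟩
    ♯ S ++ ♯L B ∷ ♯ M ++ ♯L A ∷ ♯ P       ∎

no-suc-left-of : ∀ {n i} (p : Word n) {a s} → ¬ HasInversion i (p ++ a ∷ s) → val a ≡ i →
  All (λ c → val c ≢ suc i) p
no-suc-left-of {i = i} p {a} {s} ¬inv va = All.tabulate λ c∈p vc → ¬inv (inversion c∈p vc)
  where
  inversion : ∀ {c} → c ∈ p → val c ≡ suc i → HasInversion i (p ++ a ∷ s)
  inversion {c} c∈p vc with P , M , refl ← ∈-∃++ c∈p =
    P , c , M , a , s , ++-assoc P (c ∷ M) (a ∷ s) , vc , va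

proposition8p15 : (n i : ℕ) (u v : Word n) →
    Edge n i u v → Edge n (n ∸ i) (♯ v) (♯ u)
proposition8p15 n i u v (1≤i , i<n , ¬inv-u , p , a , b , s , refl , refl , va , vb , s≢i) =
  m<n⇒0<n∸m i<n , ∸-monoʳ-< 1≤i (<⇒≤ i<n) , ¬inv-♯v ,
  ♯ s , ♯L b , ♯L a , ♯ p , ♯-++-∷ p b s , ♯-++-∷ p a s ,
  val-♯L-suc vb , val-♯L-≤ (<⇒≤ i<n) va ,
  All-♯⁺ (All.map (λ c≢ e → c≢ (♯L-val e)) (no-suc-left-of p ¬inv-u va))
  where
  ♯L-val : ∀ {c} → val (♯L c) ≡ n ∸ i → val c ≡ suc i
  ♯L-val {c} e = subst (λ d → val d ≡ suc i) (opposite-involutive c) (val-♯L-∸ (<⇒≤ i<n) e)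
  ¬inv-♯v : ¬ HasInversion (n ∸ i) (♯ (p ++ b ∷ s))
  ¬inv-♯v = ¬inv-u ∘ HasInversion-++ʳ (a ∷ s)
          ∘ HasInversion-++-∷⁻ p (λ e → 1+n≢n (trans (sym vb) e)) s≢i
          ∘ HasInversion-♯⁻ (<⇒≤ i<n)
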